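{- Let $\chi=\gamma\vee\big(\bigwedge_{i\in N}\langle A_i\rangle\varphi_i\to\bigvee_{j\in P}\langle B_j\rangle\psi_j\big)$ be a standard formula with respect to an elementary disjunction $\gamma$, a set of negative indices $N$ and a nonempty set of positive indices $P$. If (a) $\vdash_{\mathsf{MCL}}\gamma$, or (b) there are $i\in N$ and $j\in P$ with $A_i\subseteq B_j$ and $\vdash_{\mathsf{MCL}}(\varphi_{N_0}\wedge\varphi_i)\to\psi_j$, then $\vdash_{\mathsf{MCL}}\chi$.
   Context: Fix a nonempty finite set $AG$ of agents and a countable set $AP$ of atomic propositions; a coalition is any $A\subseteq AG$. The language $\Phi$: $\varphi ::= \top \mid p \mid \neg\varphi \mid (\varphi\wedge\varphi) \mid \langle A\rangle\varphi$ ($p\in AP$, $A\subseteq AG$), with $\bot,\vee,\to,\leftrightarrow$ defined as usual. $\vdash_{\mathsf{MCL}}$ denotes derivability in the system with axioms: all propositional tautologies; $\langle\emptyset\rangle(\varphi\to\psi)\to(\langle A\rangle\varphi\to\langle A\rangle\psi)$; $\langle A\rangle\varphi\to\langle B\rangle\varphi$ whenever $A\subseteq B$; $\neg\langle A\rangle\bot$; and rules: modus ponens, and from $\varphi$ infer $\langle A\rangle\psi\to\langle\emptyset\rangle\varphi$. An elementary disjunction is a disjunction of propositional literals. A set of negative indices is $\{ -n,\dots,-1\}$ for some $n\ge0$; a set of positive indices is $\{1,\dots,n\}$. A formula $\gamma\vee\big(\bigwedge_{i\in N}\langle A_i\rangle\varphi_i\to\bigvee_{j\in P}\langle B_j\rangle\psi_j\big)$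 ($P$ nonempty) is a standard formula with respect to $\gamma,N,P$ if (1) when $N\neq\emptyset$, $\langle A_i\rangle\varphi_i$ is $\langle\emptyset\rangle\top$ for some $i\in N$, and (2) $\langle B_j\rangle\psi_j$ is $\langle AG\rangle\bot$ for some $j\in P$. Put $N_0=\{i\in N:A_i=\emptyset\}$ and $\varphi_{N_0}=\bigwedge\{\varphi_i:i\in N_0\}$ (empty conjunction is $\top$). -}

module Defs where

open import Data.Nat using (ℕ; zero; suc)
open import Data.Bool using (Bool; true; false; not; _∧_)
open import Data.Fin using (Fin)
open import Data.Fin.Subset using (Subset; _⊆_; ⊤; ⊥)
open import Data.List using (List; []; _∷_; foldr; tabulate; filter; map)
open import Data.Product using (Σ; _×_; _,_; ∃)
open import Relation.Nullary using (¬_)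
open import Relation.Binary.PropositionalEquality using (_≡_)
open import Data.Vec.Properties using (≡-dec)
open import Data.Bool.Properties using () renaming (_≟_ to _≟B_)

-- Formulas over agents Fin n (AG = Fin n) and atoms AP = ℕ.
infixr 6 _∧′_
data Fm (n : ℕ) : Set where
  ⊤′   : Fm n
  atom : ℕ → Fm n
  ¬′_  : Fm n → Fm n
  _∧′_ : Fm n → Fm n → Fm n
  ⟨_⟩_ : Subset n → Fm n → Fm n

module _ {n : ℕ} where
  infixr 5 _∨′_
  infixr 4 _⇒_

  ⊥′ : Fm n
  ⊥′ = ¬′ ⊤′

  _∨′_ : Fm n → Fm n → Fm n
  φ ∨′ ψ = ¬′ (¬′ φ ∧′ ¬′ ψ)

  _⇒_ : Fm n → Fm n → Fm n
  φ ⇒ ψ = ¬′ (φ ∧′ ¬′ ψ)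

  -- Boolean evaluation treating modal formulas as propositional atoms
  eval : (ℕ → Bool) → (Subset n → Fm n → Bool) → Fm n → Bool
  eval v m ⊤′ = true
  eval v m (atom p) = v p
  eval v m (¬′ φ) = not (eval v m φ)
  eval v m (φ ∧′ ψ) = eval v m φ ∧ eval v m ψ
  eval v m (⟨ A ⟩ φ) = m A φ

  Tautology : Fm n → Set
  Tautology φ = ∀ v m → eval v m φ ≡ true

  ∅ : Subset n
  ∅ = ⊥

  AG : Subset n
  AG = ⊤

  data ⊢ : Fm n → Set where
    taut : ∀ {φ} → Tautology φ → ⊢ φ
    ax-K : ∀ {A φ ψ} → ⊢ ((⟨ ∅ ⟩ (φ ⇒ ψ)) ⇒ ((⟨ A ⟩ φ) ⇒ (⟨ A ⟩ ψ)))
    ax-mono : ∀ {A B φ} → A ⊆ B → ⊢ ((⟨ A ⟩ φ) ⇒ (⟨ B ⟩ φ))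
    ax-bot : ∀ {A} → ⊢ (¬′ (⟨ A ⟩ ⊥′))
    mp : ∀ {φ ψ} → ⊢ (φ ⇒ ψ) → ⊢ φ → ⊢ ψ
    nec : ∀ {φ A ψ} → ⊢ φ → ⊢ ((⟨ A ⟩ ψ) ⇒ (⟨ ∅ ⟩ φ))

  ⋀ : List (Fm n) → Fm n
  ⋀ = foldr _∧′_ ⊤′

  ⋁ : List (Fm n) → Fm n
  ⋁ = foldr _∨′_ ⊥′

  data Literal : Set where
    pos : ℕ → Literal
    neg : ℕ → Literal

  litFm : Literal → Fm n
  litFm (pos p) = atom p
  litFm (neg p) = ¬′ atom p

  ElemDisj : Set
  ElemDisj = List Literal

  elemFm : ElemDisj → Fm n
  elemFm γ = ⋁ (map litFm γ)

  -- The formula  γ ∨ (⋀_{i∈N} ⟨A_i⟩φ_i → ⋁_{j∈P} ⟨B_j⟩ψ_j)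
  -- with N = {-a,…,-1} indexed by Fin a and P = {1,…,suc b} indexed by Fin (suc b).
  chiFm : ∀ {a b} → ElemDisj → (Fin a → Subset n) → (Fin a → Fm n)
        → (Fin (suc b) → Subset n) → (Fin (suc b) → Fm n) → Fm n
  chiFm γ A φ B ψ =
    elemFm γ ∨′ (⋀ (tabulate (λ i → ⟨ A i ⟩ φ i)) ⇒ ⋁ (tabulate (λ j → ⟨ B j ⟩ ψ j)))

  IsStandard : ∀ {a b} → (Fin a → Subset n) → (Fin a → Fm n)
             → (Fin (suc b) → Subset n) → (Fin (suc b) → Fm n) → Set
  IsStandard {a} A φ B ψ =
    (¬ (a ≡ 0) → ∃ λ i → A i ≡ ∅ × φ i ≡ ⊤′)
    × (∃ λ j → B j ≡ AG × ψ j ≡ ⊥′)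

  phiN0 : ∀ {a} → (Fin a → Subset n) → (Fin a → Fm n) → Fm n
  phiN0 A φ = ⋀ (map φ (filter (λ i → ≡-dec _≟B_ (A i) ∅) (tabulate (λ i → i))))

{-# OPTIONS --safe #-}
-- Case (a) is weakening. For (b), the antecedent yields ⟨A_i⟩φ_i and, conjunct by
-- conjunct, ⟨∅⟩φ_{N₀}; the ⟨∅⟩⊤ needed for the empty conjunction comes by
-- necessitation from ⟨A_i⟩φ_i. Axiom K for ∅ merges the two into
-- ⟨A_i⟩(φ_{N₀} ∧ φ_i), whence ⟨A_i⟩ψ_j by monotonicity of ⟨A_i⟩ and ⟨B_j⟩ψ_j by
-- coalition monotonicity. All purely propositional steps are truth-table checks in
-- which modal formulas are atoms.
module Submission where

open import Defs
open import Data.Nat using (ℕ; suc)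
open import Data.Fin using (Fin)
open import Data.Fin.Subset using (Subset; _⊆_)
open import Data.Bool using (Bool; true; false; not; _∧_)
open import Data.List using (List; []; _∷_; tabulate)
open import Data.List.Relation.Unary.All using (All; []; _∷_)
import Data.List.Relation.Unary.All as All
open import Data.List.Relation.Unary.All.Properties using (all-filter; map⁺; tabulate⁻)
open import Data.List.Relation.Unary.Any using (Any; here; there)
open import Data.List.Relation.Unary.Any.Properties using (tabulate⁺)
open import Data.Product using (_×_; ∃₂; _,_; proj₁; proj₂)
open import Data.Sum using (_⊎_; inj₁; inj₂)
open import Function using (id)
open import Relation.Nullary using (Dec)
open import Relation.Binary.PropositionalEquality using (_≡_; refl; subst)
open import Data.Vec.Properties using (≡-dec)
open import Data.Bool.Properties using () renaming (_≟_ to _≟B_)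

private
  implication-elim : ∀ x y → not (x ∧ not y) ≡ true → x ≡ true → y ≡ true
  implication-elim true  true  _ _ = refl
  implication-elim false _     _ ()

  implication-intro : ∀ x y → (x ≡ true → y ≡ true) → not (x ∧ not y) ≡ true
  implication-intro true  true  _ = refl
  implication-intro true  false f = f refl
  implication-intro false _     _ = refl

  conjunction-elim : ∀ x y → x ∧ y ≡ true → x ≡ true × y ≡ true
  conjunction-elim true  true  _ = refl , refl
  conjunction-elim true  false ()
  conjunction-elim false _     ()

  conjunction-intro : ∀ x y → x ≡ true → y ≡ true → x ∧ y ≡ true
  conjunction-intro true true _ _ = refl

  disjunction-introˡ : ∀ x y → x ≡ true → not (not x ∧ not y) ≡ true
  disjunction-introˡ true _ _ = refl

  disjunction-introʳ : ∀ x y → y ≡ true → not (not x ∧ not y) ≡ true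
  disjunction-introʳ true  _    _ = refl
  disjunction-introʳ false true _ = refl

module _ {n : ℕ} where

  -- A record rather than  eval v m X ≡ true  so that X can be inferred.
  record Holds (v : ℕ → Bool) (m : Subset n → Fm n → Bool) (X : Fm n) : Set where
    constructor holds
    field truth : eval v m X ≡ true
  open Holds

  module _ {v : ℕ → Bool} {m : Subset n → Fm n → Bool} where

    ⊤-holds : Holds v m ⊤′
    ⊤-holds = holds refl

    ⇒-elim : ∀ {X Y} → Holds v m (X ⇒ Y) → Holds v m X → Holds v m Y
    ⇒-elim {X} {Y} (holds p) (holds q) = holds (implication-elim (eval v m X) (eval v m Y) p q)

    ⇒-intro : ∀ {X Y} → (Holds v m X → Holds v m Y) → Holds v m (X ⇒ Y)
    ⇒-intro {X} {Y} f =
      holds (implication-intro (eval v m X) (eval v m Y) (λ p → truth (f (holds p))))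

    ∧-elim : ∀ {X Y} → Holds v m (X ∧′ Y) → Holds v m X × Holds v m Y
    ∧-elim {X} {Y} (holds p) with conjunction-elim (eval v m X) (eval v m Y) p
    ... | p₁ , p₂ = holds p₁ , holds p₂

    ∧-intro : ∀ {X Y} → Holds v m X → Holds v m Y → Holds v m (X ∧′ Y)
    ∧-intro {X} {Y} (holds p) (holds q) = holds (conjunction-intro (eval v m X) (eval v m Y) p q)

    ∨-introˡ : ∀ {X Y} → Holds v m X → Holds v m (X ∨′ Y)
    ∨-introˡ {X} {Y} (holds p) = holds (disjunction-introˡ (eval v m X) (eval v m Y) p)

    ∨-introʳ : ∀ {X Y} → Holds v m Y → Holds v m (X ∨′ Y)
    ∨-introʳ {X} {Y} (holds p) = holds (disjunction-introʳ (eval v m X) (eval v m Y) p)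

    ⋀-elim : ∀ {L} → Holds v m (⋀ L) → All (Holds v m) L
    ⋀-elim {[]}    _ = []
    ⋀-elim {X ∷ L} h = proj₁ (∧-elim h) ∷ ⋀-elim (proj₂ (∧-elim h))

    ⋁-intro : ∀ {L} → Any (Holds v m) L → Holds v m (⋁ L)
    ⋁-intro (here h)  = ∨-introˡ h
    ⋁-intro (there h) = ∨-introʳ (⋁-intro h)

  ⊢-valid : ∀ {X} → (∀ v m → Holds v m X) → ⊢ X
  ⊢-valid f = taut (λ v m → truth (f v m))

  ⊢-consequence : ∀ {X Y} → (∀ {v m} → Holds v m X → Holds v m Y) → ⊢ X → ⊢ Y
  ⊢-consequence f p = mp (⊢-valid (λ v m → ⇒-intro f)) p

  ⊢-consequence₂ : ∀ {X Y Z} → (∀ {v m} → Holds v m X → Holds v m Y → Holds v m Z)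
                 → ⊢ X → ⊢ Y → ⊢ Z
  ⊢-consequence₂ f p q = mp (mp (⊢-valid (λ v m → ⇒-intro λ x → ⇒-intro (f x))) p) q

  ⇒-trans : ∀ {X Y Z} → ⊢ (X ⇒ Y) → ⊢ (Y ⇒ Z) → ⊢ (X ⇒ Z)
  ⇒-trans = ⊢-consequence₂ (λ xy yz → ⇒-intro λ x → ⇒-elim yz (⇒-elim xy x))

  ⇒-mp : ∀ {C X Y} → ⊢ (C ⇒ (X ⇒ Y)) → ⊢ (C ⇒ X) → ⊢ (C ⇒ Y)
  ⇒-mp = ⊢-consequence₂ (λ cxy cx → ⇒-intro λ c → ⇒-elim (⇒-elim cxy c) (⇒-elim cx c))

  ⇒-refl : ∀ {X} → ⊢ (X ⇒ X)
  ⇒-refl = ⊢-valid (λ v m → ⇒-intro id)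

  ⟨⟩-mono : ∀ {A X Y} → ⊢ (X ⇒ Y) → ⊢ ((⟨ A ⟩ X) ⇒ (⟨ A ⟩ Y))
  ⟨⟩-mono {A} {X} p = ⇒-mp (⇒-trans (nec {A = A} {ψ = X} p) ax-K) ⇒-refl

  ⟨⟩⇒⟨∅⟩⊤ : ∀ {A X} → ⊢ ((⟨ A ⟩ X) ⇒ (⟨ ∅ ⟩ ⊤′))
  ⟨⟩⇒⟨∅⟩⊤ = nec (⊢-valid (λ v m → ⊤-holds))

  ⟨∅⟩-∧-⟨⟩ : ∀ {A X Y} → ⊢ ((⟨ ∅ ⟩ X) ⇒ ((⟨ A ⟩ Y) ⇒ (⟨ A ⟩ (X ∧′ Y))))
  ⟨∅⟩-∧-⟨⟩ = ⇒-trans (⟨⟩-mono (⊢-valid (λ v m → ⇒-intro λ x → ⇒-intro (∧-intro x)))) ax-K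

  ⟨∅⟩-⋀ : ∀ {C} {L : List (Fm n)} → ⊢ (C ⇒ (⟨ ∅ ⟩ ⊤′))
        → All (λ X → ⊢ (C ⇒ (⟨ ∅ ⟩ X))) L → ⊢ (C ⇒ (⟨ ∅ ⟩ (⋀ L)))
  ⟨∅⟩-⋀ t []       = t
  ⟨∅⟩-⋀ t (p ∷ ps) = ⇒-mp (⇒-trans p ⟨∅⟩-∧-⟨⟩) (⟨∅⟩-⋀ t ps)

  module _ {a b : ℕ} (A : Fin a → Subset n) (φ : Fin a → Fm n)
                     (B : Fin (suc b) → Subset n) (ψ : Fin (suc b) → Fm n) where

    antecedent : Fm n
    antecedent = ⋀ (tabulate (λ i → ⟨ A i ⟩ φ i))

    consequent : Fm n
    consequent = ⋁ (tabulate (λ j → ⟨ B j ⟩ ψ j))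

    antecedent⇒conjunct : ∀ i → ⊢ (antecedent ⇒ (⟨ A i ⟩ φ i))
    antecedent⇒conjunct i = ⊢-valid (λ v m → ⇒-intro λ h → tabulate⁻ (⋀-elim h) i)

    disjunct⇒consequent : ∀ j → ⊢ ((⟨ B j ⟩ ψ j) ⇒ consequent)
    disjunct⇒consequent j =
      ⊢-valid (λ v m → ⇒-intro λ h → ⋁-intro (tabulate⁺ {f = λ j → ⟨ B j ⟩ ψ j} j h))

    antecedent⇒⟨∅⟩phiN0 : Fin a → ⊢ (antecedent ⇒ (⟨ ∅ ⟩ phiN0 A φ))
    antecedent⇒⟨∅⟩phiN0 i = ⟨∅⟩-⋀ (⇒-trans (antecedent⇒conjunct i) ⟨⟩⇒⟨∅⟩⊤)
                                  (map⁺ (All.map antecedent⇒⟨∅⟩φ (all-filter N₀? (tabulate id))))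
      where
      N₀? : ∀ i′ → Dec (A i′ ≡ ∅)
      N₀? i′ = ≡-dec _≟B_ (A i′) ∅

      antecedent⇒⟨∅⟩φ : ∀ {i′} → A i′ ≡ ∅ → ⊢ (antecedent ⇒ (⟨ ∅ ⟩ φ i′))
      antecedent⇒⟨∅⟩φ {i′} Ai′≡∅ =
        subst (λ S → ⊢ (antecedent ⇒ (⟨ S ⟩ φ i′))) Ai′≡∅ (antecedent⇒conjunct i′)

    antecedent⇒consequent : ∀ i j → A i ⊆ B j → ⊢ ((phiN0 A φ ∧′ φ i) ⇒ ψ j)
                          → ⊢ (antecedent ⇒ consequent)
    antecedent⇒consequent i j Ai⊆Bj ⊢φ⇒ψ =
      ⇒-trans antecedent⇒⟨Ai⟩[φN₀∧φi]
        (⇒-trans (⟨⟩-mono ⊢φ⇒ψ) (⇒-trans (ax-mono Ai⊆Bj) (disjunct⇒consequent j)))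
      where
      antecedent⇒⟨Ai⟩[φN₀∧φi] : ⊢ (antecedent ⇒ (⟨ A i ⟩ (phiN0 A φ ∧′ φ i)))
      antecedent⇒⟨Ai⟩[φN₀∧φi] =
        ⇒-mp (⇒-trans (antecedent⇒⟨∅⟩phiN0 i) ⟨∅⟩-∧-⟨⟩) (antecedent⇒conjunct i)

-- Standardness is not needed: the index i of (b) already supplies ⟨∅⟩⊤.
mainTheorem3 : (k : ℕ) {a b : ℕ} (γ : ElemDisj)
    (A : Fin a → Subset (suc k)) (φ : Fin a → Fm (suc k))
    (B : Fin (suc b) → Subset (suc k)) (ψ : Fin (suc b) → Fm (suc k))
    → IsStandard A φ B ψ
    → (⊢ (elemFm {suc k} γ)
       ⊎ ∃₂ (λ i j → A i ⊆ B j × ⊢ ((phiN0 A φ ∧′ φ i) ⇒ ψ j)))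
    → ⊢ (chiFm γ A φ B ψ)
mainTheorem3 k γ A φ B ψ _ (inj₁ ⊢γ) = ⊢-consequence ∨-introˡ ⊢γ
mainTheorem3 k γ A φ B ψ _ (inj₂ (i , j , Ai⊆Bj , ⊢φ⇒ψ)) =
  ⊢-consequence ∨-introʳ (antecedent⇒consequent A φ B ψ i j Ai⊆Bj ⊢φ⇒ψ)
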